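{- Let $d$ be any distance function on the edges of the complete graph on $V=\{1,\dots,n\}$, let $x$ be a Hamiltonian cycle, and let $\Pi^x$ be the matrix with $\pi_{i,j}=\pi_{\max}=1-\frac1n$ if $\{i,j\}\in x$ and $\pi_{i,j}=\pi_{\min}=\frac{1}{n(n-2)}$ otherwise ($i\neq j$), $\pi_{i,i}=0$. Then the probability that one run of the vertex-based random solution generation with distribution $\Pi^x$ produces a solution whose cost is not larger than the cost of $x$ is in $\Omega(1)$.
   Context: Hamiltonian cycles are represented by permutations $(i_1,\dots,i_n)$ of $V$; the cost is $f(s)=\sum_{j=1}^{n-1}d(\{i_j,i_{j+1}\})+d(\{i_n,i_1\})$. Vertex-based random solution generation from a matrix $\Pi=(\pi_{i,j})$: pick a start vertex $v$ uniformly at random; while unvisited vertices remain (set $U$), choose the next vertex $v'\in U$ with probability $\pi_{v,v'}/\sum_{k\in U}\pi_{v,k}$, append it and set $v=v'$; output the resulting permutation. (In the paper, $x$ is the iteration-best solution $X_t^{[1]}$ of the cross-entropy algorithm with $M=1,\rho=1$ and max-min calibration.) Asymptotic notation refers to $n\to\infty$.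
   Formalization: The distance function d takes values in the nonnegative rationals rather than the nonnegative reals. -}

module Defs where

open import Data.Bool using (Bool; true; false; if_then_else_; _∧_; _∨_)
open import Data.Integer as ℤ using (ℤ)
open import Data.Bool.ListAction using (any)
open import Data.Nat as ℕ using (ℕ; zero; suc)
open import Data.Fin as Fin using (Fin)
open import Data.Fin.Properties using () renaming (_≟_ to _≟ᶠ_)
open import Data.List using (List; []; _∷_; _++_; [_]; map; zip; foldr; allFin)
open import Data.Product using (_×_; _,_)
open import Data.Rational as ℚ using (ℚ; 0ℚ; 1ℚ; _+_; _*_; _-_; _÷_; _≤ᵇ_; ≢-nonZero)
open import Data.Rational.Properties using () renaming (_≟_ to _≟ℚ_)
open import Relation.Nullary using (yes; no; does)

ℕtoℚ : ℕ → ℚ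
ℕtoℚ k = ℤ.+ k ℚ./ 1

-- total division: p / q, and 0 when q = 0 (never used with q = 0 for n ≥ 3)
safeDiv : ℚ → ℚ → ℚ
safeDiv p q with q ≟ℚ 0ℚ
... | yes _ = 0ℚ
... | no q≢0 = _÷_ p q {{≢-nonZero q≢0}}

sumℚ : List ℚ → ℚ
sumℚ = foldr _+_ 0ℚ

cycEdges : ∀ {A : Set} → List A → List (A × A)
cycEdges []       = []
cycEdges (a ∷ as) = zip (a ∷ as) (as ++ [ a ])

cost : ∀ {n} → (Fin n → Fin n → ℚ) → List (Fin n) → ℚ
cost d s = sumℚ (map (λ { (i , j) → d i j }) (cycEdges s))

isEdge : ∀ {n} → List (Fin n) → Fin n → Fin n → Bool
isEdge x i j = any (λ { (a , b) → (does (a ≟ᶠ i) ∧ does (b ≟ᶠ j)) ∨ (does (a ≟ᶠ j) ∧ does (b ≟ᶠ i)) }) (cycEdges x)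

πmax : ℕ → ℚ
πmax n = 1ℚ - safeDiv 1ℚ (ℕtoℚ n)

πmin : ℕ → ℚ
πmin n = safeDiv 1ℚ (ℕtoℚ (n ℕ.* (n ℕ.∸ 2)))

Πx : ∀ n → List (Fin n) → Fin n → Fin n → ℚ
Πx n x i j with i ≟ᶠ j
... | yes _ = 0ℚ
... | no _  = if isEdge x i j then πmax n else πmin n

picks : ∀ {A : Set} → List A → List (A × List A)
picks []       = []
picks (a ∷ as) = (a , as) ∷ map (λ { (b , bs) → (b , a ∷ bs) }) (picks as)

indicator : Bool → ℚ
indicator true  = 1ℚ
indicator false = 0ℚ

-- probability that the remaining construction, from current vertex v with
-- unvisited set U and partial permutation 'path', ends in a permutation s with
-- cost s ≤ c.  The first argument is fuel (≥ |U| in actual use).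
runProb : ∀ {n} → (Fin n → Fin n → ℚ) → (Fin n → Fin n → ℚ) → ℚ →
          ℕ → Fin n → List (Fin n) → List (Fin n) → ℚ
runProb π d c _ v [] path = indicator (cost d path ≤ᵇ c)
runProb π d c zero v (_ ∷ _) path = 0ℚ
runProb π d c (suc k) v U@(_ ∷ _) path =
  sumℚ (map (λ { (v' , U') → safeDiv (π v v') (sumℚ (map (π v) U))
                              * runProb π d c k v' U' (path ++ [ v' ]) })
            (picks U))

genProb : ∀ n → (Fin n → Fin n → ℚ) → (Fin n → Fin n → ℚ) → ℚ → ℚ
genProb n π d c =
  sumℚ (map (λ { (v , U) → safeDiv 1ℚ (ℕtoℚ n) * runProb π d c n v U [ v ] })
            (picks (allFin n)))

-- From every start vertex v the walk retraces the tour x, leaving v towards one of its two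
-- neighbours, with probability at least 1/12, and the permutation produced then has exactly
-- the cost of x (so nothing about d is used). At the first step the chosen neighbour competes
-- with the other neighbour and n - 3 vertices of weight πmin, which gives a factor ≥ 1/4. Later,
-- with K unvisited non-neighbours left, the next tour vertex is taken with probability
-- πmax/(πmax + Kπmin) ≥ 1 - (4/3)Kπmin, and these factors multiply to at least
-- 1 - (2/3)πmin(n-2)² ≥ 1/3 since πmin = 1/(n(n-2)). Uniqueness of successors and predecessors on
-- the tour identifies which weights are πmax.
module Submission where

open import Defs
open import Data.Nat using (ℕ)
open import Data.Fin using (Fin)
open import Data.List using (List; allFin)
open import Data.List.Relation.Binary.Permutation.Propositional using (_↭_)
open import Data.Product using (Σ; _×_)
open import Data.Rational using (ℚ; 0ℚ; _<_; _≤_)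
open import Relation.Binary.PropositionalEquality using (_≡_)

import Data.Nat as ℕ
import Data.Nat.Properties as ℕP
import Data.Nat.Coprimality as Coprimality
import Data.Integer as ℤ
import Data.Integer.Properties as ℤP
import Data.List.Properties as List
import Data.List.Relation.Binary.Permutation.Setoid.Properties as Permutationₛ
import Data.List.Relation.Unary.All as All
import Data.List.Relation.Unary.AllPairs as AllPairs
import Data.List.Relation.Unary.Any as Any
open import Data.Nat using (zero; suc)
open import Data.Bool using (Bool; true; false; T; _∧_; _∨_)
open import Data.Bool.Properties using (T-∧; T-∨; T-≡; ∨-zeroʳ)
open import Data.Empty using (⊥-elim)
open import Data.Sum using (_⊎_; inj₁; inj₂; [_,_]′)
import Data.Sum as Sum
open import Data.Product using (_,_; proj₁; proj₂)
open import Data.Fin.Properties using () renaming (_≟_ to _≟ᶠ_)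
open import Data.List using ([]; _∷_; _++_; [_]; map; zip; length)
open import Data.List.Membership.Propositional using (_∈_; _∉_)
open import Data.List.Membership.Propositional.Properties using (∈-map⁺; ∈-map⁻; ∈-∃++; ∈-++⁺ˡ; ∈-++⁺ʳ)
open import Data.List.Relation.Unary.Any using (here; there)
open import Data.List.Relation.Unary.Any.Properties using (any⁺; any⁻; Any-⊎⁻)
open import Data.List.Relation.Unary.AllPairs using (_∷_)
open import Data.List.Relation.Unary.Linked as Linked using (Linked; []; [-]; _∷_)
open import Data.List.Relation.Unary.Unique.Propositional using (Unique)
open import Data.List.Relation.Unary.Unique.Propositional.Properties using (allFin⁺; Unique[x∷xs]⇒x∉xs)
open import Data.List.Relation.Binary.Permutation.Propositional
  using (↭-refl; ↭-sym; ↭-trans; ↭-prep; ↭-swap; ↭⇒↭ₛ)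
open import Data.List.Relation.Binary.Permutation.Propositional.Properties
  using (∈-resp-↭; drop-∷; shift; ++-comm; ↭-length; ↭-empty-inv; map⁺)
open import Data.Rational as ℚ
  using (1ℚ; _+_; _*_; _-_; -_; _÷_; 1/_; _≤ᵇ_; *≤*; *<*; ≢-nonZero; nonNegative; positive)
open import Data.Rational.Properties
  using (≤-refl; ≤-reflexive; ≤-trans; ≤-total; <-≤-trans; <⇒≤; <⇒≢; <-irrefl; <-cmp; ≤⇒≤ᵇ; _≟_;
         +-mono-≤; +-monoʳ-≤; +-monoˡ-≤; +-identityʳ; +-identityˡ; +-assoc; +-inverseʳ; +-0-isCommutativeMonoid;
         *-zeroʳ; *-zeroˡ; *-identityʳ; *-identityˡ; *-assoc; *-comm; *-inverseʳ; *-inverseˡ;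
         *-monoˡ-≤-nonNeg; *-monoʳ-≤-nonNeg; positive⁻¹; 1/pos⇒pos; normalize-coprime; module ≤-Reasoning)
open import Data.Rational.Solver using (module +-*-Solver)
open import Function using (_∘_; Equivalence)
open import Relation.Binary.Definitions using (tri<; tri≈; tri>)
open import Relation.Binary.PropositionalEquality
  using (refl; sym; trans; cong; cong₂; subst; subst₂; setoid; _≢_; ≢-sym; module ≡-Reasoning)
open import Relation.Nullary using (does; yes; no)
open import Relation.Nullary.Decidable using (dec-true)
open +-*-Solver

≤-by-gap : ∀ {p q} r → q ≡ p + r → 0ℚ ≤ r → p ≤ q
≤-by-gap {p} {q} r q≡p+r 0≤r = subst₂ _≤_ (+-identityʳ p) (sym q≡p+r) (+-monoʳ-≤ p 0≤r)

p≤q⇒0≤q-p : ∀ {p q} → p ≤ q → 0ℚ ≤ q - p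
p≤q⇒0≤q-p {p} {q} p≤q = subst (_≤ q - p) (+-inverseʳ p) (+-monoˡ-≤ (- p) p≤q)

*-monoˡ-≤-0≤ : ∀ {r p q} → 0ℚ ≤ r → p ≤ q → r * p ≤ r * q
*-monoˡ-≤-0≤ {r} 0≤r = *-monoˡ-≤-nonNeg r {{nonNegative 0≤r}}

*-monoʳ-≤-0≤ : ∀ {r p q} → 0ℚ ≤ r → p ≤ q → p * r ≤ q * r
*-monoʳ-≤-0≤ {r} 0≤r = *-monoʳ-≤-nonNeg r {{nonNegative 0≤r}}

*-nonNeg : ∀ {p q} → 0ℚ ≤ p → 0ℚ ≤ q → 0ℚ ≤ p * q
*-nonNeg {p} 0≤p 0≤q = subst (_≤ p * _) (*-zeroʳ p) (*-monoˡ-≤-0≤ 0≤p 0≤q)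

+-nonNeg : ∀ {p q} → 0ℚ ≤ p → 0ℚ ≤ q → 0ℚ ≤ p + q
+-nonNeg = +-mono-≤

0≤1 : 0ℚ ≤ 1ℚ
0≤1 = *≤* (ℤ.+≤+ ℕ.z≤n)

ℕtoℚ-suc : ∀ k → ℕtoℚ (suc k) ≡ 1ℚ + ℕtoℚ k
ℕtoℚ-suc k rewrite normalize-coprime {k} {0} (Coprimality.sym (Coprimality.1-coprimeTo k)) =
  cong (ℚ._/ 1) (cong (λ z → ℤ.+ 1 ℤ.+ z) (sym (ℤP.*-identityʳ (ℤ.+ k))))

ℕtoℚ-+ : ∀ m n → ℕtoℚ (m ℕ.+ n) ≡ ℕtoℚ m + ℕtoℚ n
ℕtoℚ-+ zero    n = sym (+-identityˡ (ℕtoℚ n))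
ℕtoℚ-+ (suc m) n = begin
  ℕtoℚ (suc (m ℕ.+ n))        ≡⟨ ℕtoℚ-suc (m ℕ.+ n) ⟩
  1ℚ + ℕtoℚ (m ℕ.+ n)         ≡⟨ cong (1ℚ +_) (ℕtoℚ-+ m n) ⟩
  1ℚ + (ℕtoℚ m + ℕtoℚ n)      ≡⟨ sym (+-assoc 1ℚ (ℕtoℚ m) (ℕtoℚ n)) ⟩
  1ℚ + ℕtoℚ m + ℕtoℚ n        ≡⟨ cong (_+ ℕtoℚ n) (sym (ℕtoℚ-suc m)) ⟩
  ℕtoℚ (suc m) + ℕtoℚ n       ∎
  where open ≡-Reasoning

ℕtoℚ-* : ∀ m n → ℕtoℚ (m ℕ.* n) ≡ ℕtoℚ m * ℕtoℚ n
ℕtoℚ-* zero    n = sym (*-zeroˡ (ℕtoℚ n))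
ℕtoℚ-* (suc m) n = begin
  ℕtoℚ (n ℕ.+ m ℕ.* n)        ≡⟨ ℕtoℚ-+ n (m ℕ.* n) ⟩
  ℕtoℚ n + ℕtoℚ (m ℕ.* n)     ≡⟨ cong (ℕtoℚ n +_) (ℕtoℚ-* m n) ⟩
  ℕtoℚ n + ℕtoℚ m * ℕtoℚ n    ≡⟨ solve 2 (λ M N → N :+ M :* N := (con 1ℚ :+ M) :* N) refl (ℕtoℚ m) (ℕtoℚ n) ⟩
  (1ℚ + ℕtoℚ m) * ℕtoℚ n      ≡⟨ cong (_* ℕtoℚ n) (sym (ℕtoℚ-suc m)) ⟩
  ℕtoℚ (suc m) * ℕtoℚ n       ∎
  where open ≡-Reasoning

ℕtoℚ-nonNeg : ∀ k → 0ℚ ≤ ℕtoℚ k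
ℕtoℚ-nonNeg zero    = ≤-refl
ℕtoℚ-nonNeg (suc k) = subst (0ℚ ≤_) (sym (ℕtoℚ-suc k)) (+-nonNeg 0≤1 (ℕtoℚ-nonNeg k))

ℕtoℚ-mono-≤ : ∀ {m n} → m ℕ.≤ n → ℕtoℚ m ≤ ℕtoℚ n
ℕtoℚ-mono-≤ {zero}  {n}     _           = ℕtoℚ-nonNeg n
ℕtoℚ-mono-≤ {suc m} {suc n} (ℕ.s≤s m≤n) =
  subst₂ _≤_ (sym (ℕtoℚ-suc m)) (sym (ℕtoℚ-suc n)) (+-monoʳ-≤ 1ℚ (ℕtoℚ-mono-≤ m≤n))

ℕtoℚ-positive : ∀ k → .{{ℕ.NonZero k}} → 0ℚ < ℕtoℚ k
ℕtoℚ-positive (suc k) =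
  <-≤-trans (*<* (ℤ.+<+ (ℕ.s≤s ℕ.z≤n)))
            (subst (1ℚ ≤_) (sym (ℕtoℚ-suc k)) (≤-by-gap (ℕtoℚ k) refl (ℕtoℚ-nonNeg k)))

safeDiv-≢0 : ∀ p {q} (q≢0 : q ≢ 0ℚ) → safeDiv p q ≡ (p ÷ q) {{≢-nonZero q≢0}}
safeDiv-≢0 p {q} q≢0 with q ≟ 0ℚ
... | yes q≡0 = ⊥-elim (q≢0 q≡0)
... | no _    = refl

safeDiv-*-cancel : ∀ p {q} → q ≢ 0ℚ → safeDiv p q * q ≡ p
safeDiv-*-cancel p {q} q≢0 = begin
  safeDiv p q * q       ≡⟨ cong (_* q) (safeDiv-≢0 p q≢0) ⟩
  p * (1/ q) * q        ≡⟨ *-assoc p (1/ q) q ⟩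
  p * ((1/ q) * q)      ≡⟨ cong (p *_) (*-inverseˡ q) ⟩
  p * 1ℚ                ≡⟨ *-identityʳ p ⟩
  p                     ∎
  where open ≡-Reasoning
        instance _ = ≢-nonZero q≢0

1/-nonNeg : ∀ {q} (q≢0 : q ≢ 0ℚ) → 0ℚ < q → 0ℚ ≤ (1/ q) {{≢-nonZero q≢0}}
1/-nonNeg {q} q≢0 0<q = <⇒≤ (positive⁻¹ _ {{1/pos⇒pos q {{positive 0<q}}}})

safeDiv-nonNeg : ∀ {p q} → 0ℚ ≤ p → 0ℚ ≤ q → 0ℚ ≤ safeDiv p q
safeDiv-nonNeg {p} {q} 0≤p 0≤q with q ≟ 0ℚ
... | yes _   = ≤-refl
... | no q≢0 = *-nonNeg 0≤p (1/-nonNeg q≢0 (0<q q≢0))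
  where
  0<q : q ≢ 0ℚ → 0ℚ < q
  0<q q≢0 with <-cmp 0ℚ q
  ... | tri< 0<q _ _ = 0<q
  ... | tri≈ _ 0≡q _ = ⊥-elim (q≢0 (sym 0≡q))
  ... | tri> _ _ q<0 = ⊥-elim (<-irrefl refl (<-≤-trans q<0 0≤q))

≤-safeDiv : ∀ {p q r} → 0ℚ < q → r * q ≤ p → r ≤ safeDiv p q
≤-safeDiv {p} {q} {r} 0<q rq≤p = begin
  r                 ≡⟨ sym (*-identityʳ r) ⟩
  r * 1ℚ            ≡⟨ cong (r *_) (sym (*-inverseʳ q)) ⟩
  r * (q * 1/ q)    ≡⟨ sym (*-assoc r q (1/ q)) ⟩
  r * q * 1/ q      ≤⟨ *-monoʳ-≤-0≤ (1/-nonNeg q≢0 0<q) rq≤p ⟩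
  p * 1/ q          ≡⟨ sym (safeDiv-≢0 p q≢0) ⟩
  safeDiv p q       ∎
  where open ≤-Reasoning
        q≢0 = ≢-sym (<⇒≢ 0<q)
        instance _ = ≢-nonZero q≢0

¼ ½ ⅓ ⅔ ¾ ⁴⁄₃ ⅛ 1/12 : ℚ
¼ = ℤ.+ 1 ℚ./ 4
½ = ℤ.+ 1 ℚ./ 2
⅓ = ℤ.+ 1 ℚ./ 3
⅔ = ℤ.+ 2 ℚ./ 3
¾ = ℤ.+ 3 ℚ./ 4
⁴⁄₃ = ℤ.+ 4 ℚ./ 3
⅛ = ℤ.+ 1 ℚ./ 8
1/12 = ℤ.+ 1 ℚ./ 12

0≤¼ 0≤½ 0≤⅓ 0≤⅔ 0≤¾ 0≤⁴⁄₃ 0≤⅛ : 0ℚ ≤ _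
0≤¼ = *≤* {q = ¼} (ℤ.+≤+ ℕ.z≤n)
0≤½ = *≤* {q = ½} (ℤ.+≤+ ℕ.z≤n)
0≤⅓ = *≤* {q = ⅓} (ℤ.+≤+ ℕ.z≤n)
0≤⅔ = *≤* {q = ⅔} (ℤ.+≤+ ℕ.z≤n)
0≤¾ = *≤* {q = ¾} (ℤ.+≤+ ℕ.z≤n)
0≤⁴⁄₃ = *≤* {q = ⁴⁄₃} (ℤ.+≤+ ℕ.z≤n)
0≤⅛ = *≤* {q = ⅛} (ℤ.+≤+ ℕ.z≤n)

-- The chance of moving to the next tour vertex (weight a) at each of k steps, where at the
-- step with K other unvisited vertices each of those has weight b.
tourFollowProb : ℚ → ℚ → ℕ → ℚ
tourFollowProb a b zero    = 1ℚ
tourFollowProb a b (suc k) = safeDiv a (a + ℕtoℚ k * b) * tourFollowProb a b k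

module _ {a b : ℚ} (¾≤a : ¾ ≤ a) (0≤b : 0ℚ ≤ b) where

  private
    0<a : 0ℚ < a
    0<a = <-≤-trans (*<* (ℤ.+<+ (ℕ.s≤s ℕ.z≤n))) ¾≤a

    0≤a : 0ℚ ≤ a
    0≤a = <⇒≤ 0<a

    0≤⁴⁄₃a-1 : 0ℚ ≤ ⁴⁄₃ * a - 1ℚ
    0≤⁴⁄₃a-1 = subst (0ℚ ≤_) (solve 1 (λ a → con ⁴⁄₃ :* (a :- con ¾) := con ⁴⁄₃ :* a :- con 1ℚ) refl a)
                 (*-nonNeg 0≤⁴⁄₃ (p≤q⇒0≤q-p ¾≤a))

  stepProb-nonNeg : ∀ {K} → 0ℚ ≤ K → 0ℚ ≤ safeDiv a (a + K * b)
  stepProb-nonNeg 0≤K = safeDiv-nonNeg 0≤a (+-nonNeg 0≤a (*-nonNeg 0≤K 0≤b))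

  stepProb-≥ : ∀ {K} → 0ℚ ≤ K → 1ℚ - ⁴⁄₃ * b * K ≤ safeDiv a (a + K * b)
  stepProb-≥ {K} 0≤K = ≤-safeDiv (<-≤-trans 0<a (≤-by-gap (K * b) refl 0≤Kb))
    (≤-by-gap (K * b * (⁴⁄₃ * a - 1ℚ) + ⁴⁄₃ * b * b * K * K)
      (solve 3 (λ a b K → a := (con 1ℚ :- con ⁴⁄₃ :* b :* K) :* (a :+ K :* b)
                               :+ (K :* b :* (con ⁴⁄₃ :* a :- con 1ℚ) :+ con ⁴⁄₃ :* b :* b :* K :* K)) refl a b K)
      (+-nonNeg (*-nonNeg 0≤Kb 0≤⁴⁄₃a-1) (*-nonNeg (*-nonNeg (*-nonNeg (*-nonNeg 0≤⁴⁄₃ 0≤b) 0≤b) 0≤K) 0≤K)))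
    where 0≤Kb = *-nonNeg 0≤K 0≤b

  tourFollowProb-nonNeg : ∀ k → 0ℚ ≤ tourFollowProb a b k
  tourFollowProb-nonNeg zero    = 0≤1
  tourFollowProb-nonNeg (suc k) = *-nonNeg (stepProb-nonNeg (ℕtoℚ-nonNeg k)) (tourFollowProb-nonNeg k)

  -- In the induction step (1 - ⁴⁄₃bK)(1 - ⅔bK²) ≥ 1 - ⅔b(K+1)² as long as the second factor is nonnegative.
  tourFollowProb-≥ : ∀ k → 1ℚ - ⅔ * b * (ℕtoℚ k * ℕtoℚ k) ≤ tourFollowProb a b k
  tourFollowProb-≥ zero =
    ≤-by-gap 0ℚ (solve 1 (λ b → con 1ℚ := con 1ℚ :- con ⅔ :* b :* (con 0ℚ :* con 0ℚ) :+ con 0ℚ) refl b) ≤-refl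
  tourFollowProb-≥ (suc k) with ≤-total 0ℚ (1ℚ - ⅔ * b * (K * K))
    where K = ℕtoℚ k
  ... | inj₁ 0≤bound = begin
    1ℚ - ⅔ * b * (ℕtoℚ (suc k) * ℕtoℚ (suc k))     ≡⟨ cong (λ z → 1ℚ - ⅔ * b * (z * z)) (ℕtoℚ-suc k) ⟩
    1ℚ - ⅔ * b * ((1ℚ + K) * (1ℚ + K))             ≤⟨ ≤-by-gap (⁴⁄₃ * ⅔ * b * b * K * K * K + ⅔ * b)
      (solve 2 (λ b K → (con 1ℚ :- con ⁴⁄₃ :* b :* K) :* (con 1ℚ :- con ⅔ :* b :* (K :* K))
                        := con 1ℚ :- con ⅔ :* b :* ((con 1ℚ :+ K) :* (con 1ℚ :+ K))
                           :+ (con ⁴⁄₃ :* con ⅔ :* b :* b :* K :* K :* K :+ con ⅔ :* b)) refl b K)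
      (+-nonNeg (*-nonNeg (*-nonNeg (*-nonNeg (*-nonNeg (*-nonNeg (*-nonNeg 0≤⁴⁄₃ 0≤⅔) 0≤b) 0≤b) 0≤K) 0≤K) 0≤K)
                (*-nonNeg 0≤⅔ 0≤b)) ⟩
    (1ℚ - ⁴⁄₃ * b * K) * (1ℚ - ⅔ * b * (K * K))     ≤⟨ *-monoʳ-≤-0≤ 0≤bound (stepProb-≥ 0≤K) ⟩
    safeDiv a (a + K * b) * (1ℚ - ⅔ * b * (K * K)) ≤⟨ *-monoˡ-≤-0≤ (stepProb-nonNeg 0≤K) (tourFollowProb-≥ k) ⟩
    safeDiv a (a + K * b) * tourFollowProb a b k    ∎
    where open ≤-Reasoning
          K = ℕtoℚ k
          0≤K = ℕtoℚ-nonNeg k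
  ... | inj₂ bound≤0 = begin
    1ℚ - ⅔ * b * (ℕtoℚ (suc k) * ℕtoℚ (suc k))     ≡⟨ cong (λ z → 1ℚ - ⅔ * b * (z * z)) (ℕtoℚ-suc k) ⟩
    1ℚ - ⅔ * b * ((1ℚ + K) * (1ℚ + K))             ≤⟨ ≤-by-gap (⅔ * b * (1ℚ + K + K))
      (solve 2 (λ b K → con 1ℚ :- con ⅔ :* b :* (K :* K)
                        := con 1ℚ :- con ⅔ :* b :* ((con 1ℚ :+ K) :* (con 1ℚ :+ K)) :+ con ⅔ :* b :* (con 1ℚ :+ K :+ K)) refl b K)
      (*-nonNeg (*-nonNeg 0≤⅔ 0≤b) (+-nonNeg (+-nonNeg 0≤1 0≤K) 0≤K)) ⟩
    1ℚ - ⅔ * b * (K * K)                           ≤⟨ bound≤0 ⟩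
    0ℚ                                             ≤⟨ *-nonNeg (stepProb-nonNeg 0≤K) (tourFollowProb-nonNeg k) ⟩
    safeDiv a (a + K * b) * tourFollowProb a b k    ∎
    where open ≤-Reasoning
          K = ℕtoℚ k
          0≤K = ℕtoℚ-nonNeg k

  -- The start vertex picks w₁ against j non-neighbours (weight b) and its other tour neighbour (weight a).
  firstStep*tourFollowProb-≥ : ∀ j → b * ℕtoℚ j ≤ 1ℚ → b * (ℕtoℚ (suc j) * ℕtoℚ (suc j)) ≤ 1ℚ →
    1/12 ≤ safeDiv a (a + (ℕtoℚ j * b + (a + 0ℚ))) * tourFollowProb a b (suc j)
  firstStep*tourFollowProb-≥ j bj≤1 bk²≤1 = begin
    1/12                                        ≡⟨ refl ⟩
    ¼ * ⅓                                       ≤⟨ *-monoʳ-≤-0≤ 0≤⅓ ¼≤first ⟩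
    first * ⅓                                   ≤⟨ *-monoˡ-≤-0≤ (safeDiv-nonNeg 0≤a (<⇒≤ 0<S)) ⅓≤follow ⟩
    first * tourFollowProb a b (suc j)          ∎
    where
    open ≤-Reasoning
    J = ℕtoℚ j
    K = ℕtoℚ (suc j)
    S = a + (J * b + (a + 0ℚ))
    first = safeDiv a S
    0<S : 0ℚ < S
    0<S = <-≤-trans 0<a (≤-by-gap (J * b + (a + 0ℚ)) refl
            (+-nonNeg (*-nonNeg (ℕtoℚ-nonNeg j) 0≤b) (subst (0ℚ ≤_) (sym (+-identityʳ a)) 0≤a)))
    ¼≤first : ¼ ≤ first
    ¼≤first = ≤-safeDiv 0<S (≤-by-gap (¼ * (1ℚ - b * J) + ½ * (a - ¾) + ⅛)
      (solve 3 (λ a b J → a := con ¼ :* (a :+ (J :* b :+ (a :+ con 0ℚ)))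
                               :+ (con ¼ :* (con 1ℚ :- b :* J) :+ con ½ :* (a :- con ¾) :+ con ⅛)) refl a b J)
      (+-nonNeg (+-nonNeg (*-nonNeg 0≤¼ (p≤q⇒0≤q-p bj≤1)) (*-nonNeg 0≤½ (p≤q⇒0≤q-p ¾≤a))) 0≤⅛))
    ⅓≤follow : ⅓ ≤ tourFollowProb a b (suc j)
    ⅓≤follow = ≤-trans (≤-by-gap (⅔ * (1ℚ - b * (K * K)))
      (solve 2 (λ b K → con 1ℚ :- con ⅔ :* b :* (K :* K) := con ⅓ :+ con ⅔ :* (con 1ℚ :- b :* (K :* K))) refl b K)
      (*-nonNeg 0≤⅔ (p≤q⇒0≤q-p bk²≤1))) (tourFollowProb-≥ (suc j))

private variable
  A : Set

sumℚ-↭ : ∀ {xs ys : List ℚ} → xs ↭ ys → sumℚ xs ≡ sumℚ ys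
sumℚ-↭ xs↭ys = Permutationₛ.foldr-commMonoid (setoid ℚ) +-0-isCommutativeMonoid (↭⇒↭ₛ xs↭ys)

sumℚ-++ : ∀ (xs ys : List ℚ) → sumℚ (xs ++ ys) ≡ sumℚ xs + sumℚ ys
sumℚ-++ []       ys = sym (+-identityˡ (sumℚ ys))
sumℚ-++ (x ∷ xs) ys = trans (cong (x +_) (sumℚ-++ xs ys)) (sym (+-assoc x (sumℚ xs) (sumℚ ys)))

module _ (f : A → ℚ) where

  sumℚ-map-nonNeg : (∀ x → 0ℚ ≤ f x) → ∀ xs → 0ℚ ≤ sumℚ (map f xs)
  sumℚ-map-nonNeg 0≤f []       = ≤-refl
  sumℚ-map-nonNeg 0≤f (x ∷ xs) = +-nonNeg (0≤f x) (sumℚ-map-nonNeg 0≤f xs)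

  ≤-sumℚ-map : (∀ x → 0ℚ ≤ f x) → ∀ {x xs} → x ∈ xs → f x ≤ sumℚ (map f xs)
  ≤-sumℚ-map 0≤f {xs = _ ∷ xs} (here refl) = ≤-by-gap (sumℚ (map f xs)) refl (sumℚ-map-nonNeg 0≤f xs)
  ≤-sumℚ-map 0≤f {xs = y ∷ xs} (there x∈xs) =
    ≤-trans (≤-sumℚ-map 0≤f x∈xs)
            (subst (_≤ f y + sumℚ (map f xs)) (+-identityˡ (sumℚ (map f xs))) (+-mono-≤ (0≤f y) ≤-refl))

  private
    ℕtoℚ-suc-* : ∀ k c → ℕtoℚ (suc k) * c ≡ c + ℕtoℚ k * c
    ℕtoℚ-suc-* k c rewrite ℕtoℚ-suc k = solve 2 (λ K c → (con 1ℚ :+ K) :* c := c :+ K :* c) refl (ℕtoℚ k) c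

  sumℚ-map-≥ : ∀ {c} xs → (∀ {x} → x ∈ xs → c ≤ f x) → ℕtoℚ (length xs) * c ≤ sumℚ (map f xs)
  sumℚ-map-≥ {c} []       _   = ≤-reflexive (*-zeroˡ c)
  sumℚ-map-≥ {c} (x ∷ xs) c≤f = subst (_≤ f x + _) (sym (ℕtoℚ-suc-* (length xs) c))
    (+-mono-≤ (c≤f (here refl)) (sumℚ-map-≥ xs (c≤f ∘ there)))

  sumℚ-map-const : ∀ {c} xs → (∀ {x} → x ∈ xs → f x ≡ c) → sumℚ (map f xs) ≡ ℕtoℚ (length xs) * c
  sumℚ-map-const {c} []       _   = sym (*-zeroˡ c)
  sumℚ-map-const {c} (x ∷ xs) f≡c = trans (cong₂ _+_ (f≡c (here refl)) (sumℚ-map-const xs (λ m → f≡c (there m))))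
    (sym (ℕtoℚ-suc-* (length xs) c))

∈-picks : ∀ {b : A} {U} → b ∈ U → Σ (List A) λ U′ → (b , U′) ∈ picks U × b ∷ U′ ↭ U
∈-picks {U = a ∷ U} (here refl)  = U , here refl , ↭-refl
∈-picks {U = a ∷ U} (there b∈U) with ∈-picks b∈U
... | U′ , m , b∷U′↭U = a ∷ U′ , there (∈-map⁺ _ m) , ↭-trans (↭-swap _ _ ↭-refl) (↭-prep a b∷U′↭U)

picks-↭ : ∀ {v : A} {U} xs → (v , U) ∈ picks xs → v ∷ U ↭ xs
picks-↭ (a ∷ xs) (here refl) = ↭-refl
picks-↭ (a ∷ xs) (there m) with ∈-map⁻ _ m
... | _ , m′ , refl = ↭-trans (↭-swap _ _ ↭-refl) (↭-prep a (picks-↭ xs m′))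

length-allFin : ∀ n → length (allFin n) ≡ n
length-allFin n = List.length-tabulate {n = n} (λ i → i)

length-picks : ∀ (xs : List A) → length (picks xs) ≡ length xs
length-picks []       = refl
length-picks (a ∷ xs) = cong suc (trans (List.length-map _ (picks xs)) (length-picks xs))

Unique-resp-↭ : ∀ {xs ys : List A} → xs ↭ ys → Unique xs → Unique ys
Unique-resp-↭ {A = A} xs↭ys = Permutationₛ.Unique-resp-↭ (setoid A) (↭⇒↭ₛ xs↭ys)

length≡suc⇒∷ʳ : ∀ (xs : List A) k → length xs ≡ suc k →
          Σ (List A) λ ys → Σ A λ y → xs ≡ ys ++ [ y ] × length ys ≡ k
length≡suc⇒∷ʳ (x ∷ [])     zero    _  = [] , x , refl , refl
length≡suc⇒∷ʳ (x ∷ y ∷ xs) (suc k) eq with length≡suc⇒∷ʳ (y ∷ xs) k (ℕP.suc-injective eq)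
... | ys , z , eq′ , len = x ∷ ys , z , cong (x ∷_) eq′ , cong suc len

module _ {B : Set} where

  ∈-zip⁻ˡ : ∀ {a : A} {b : B} {xs ys} → (a , b) ∈ zip xs ys → a ∈ xs
  ∈-zip⁻ˡ {xs = _ ∷ _} {_ ∷ _} (here refl) = here refl
  ∈-zip⁻ˡ {xs = _ ∷ _} {_ ∷ _} (there m)   = there (∈-zip⁻ˡ m)

  ∈-zip⁻ʳ : ∀ {a : A} {b : B} {xs ys} → (a , b) ∈ zip xs ys → b ∈ ys
  ∈-zip⁻ʳ {xs = _ ∷ _} {_ ∷ _} (here refl) = here refl
  ∈-zip⁻ʳ {xs = _ ∷ _} {_ ∷ _} (there m)   = there (∈-zip⁻ʳ m)

  zip-functionalˡ : ∀ {a : A} {b c : B} {xs ys} → Unique xs → (a , b) ∈ zip xs ys → (a , c) ∈ zip xs ys → b ≡ c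
  zip-functionalˡ {xs = _ ∷ _} {_ ∷ _} _          (here refl) (here refl) = refl
  zip-functionalˡ {xs = _ ∷ _} {_ ∷ _} (x∉ ∷ _)   (here refl) (there m)   = ⊥-elim (All.lookup x∉ (∈-zip⁻ˡ m) refl)
  zip-functionalˡ {xs = _ ∷ _} {_ ∷ _} (x∉ ∷ _)   (there m)   (here refl) = ⊥-elim (All.lookup x∉ (∈-zip⁻ˡ m) refl)
  zip-functionalˡ {xs = _ ∷ _} {_ ∷ _} (_ ∷ uxs)  (there m)   (there m′)  = zip-functionalˡ uxs m m′

  zip-functionalʳ : ∀ {a b : A} {c : B} {xs ys} → Unique ys → (a , c) ∈ zip xs ys → (b , c) ∈ zip xs ys → a ≡ b
  zip-functionalʳ {xs = _ ∷ _} {_ ∷ _} _          (here refl) (here refl) = refl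
  zip-functionalʳ {xs = _ ∷ _} {_ ∷ _} (y∉ ∷ _)   (here refl) (there m)   = ⊥-elim (All.lookup y∉ (∈-zip⁻ʳ m) refl)
  zip-functionalʳ {xs = _ ∷ _} {_ ∷ _} (y∉ ∷ _)   (there m)   (here refl) = ⊥-elim (All.lookup y∉ (∈-zip⁻ʳ m) refl)
  zip-functionalʳ {xs = _ ∷ _} {_ ∷ _} (_ ∷ uys)  (there m)   (there m′)  = zip-functionalʳ uys m m′

cycEdges-successor-unique : ∀ {a b c : A} r → Unique r → (a , b) ∈ cycEdges r → (a , c) ∈ cycEdges r → b ≡ c
cycEdges-successor-unique (_ ∷ _) = zip-functionalˡ

cycEdges-predecessor-unique : ∀ {a b c : A} r → Unique r → (a , c) ∈ cycEdges r → (b , c) ∈ cycEdges r → a ≡ b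
cycEdges-predecessor-unique (x ∷ xs) ur = zip-functionalʳ (Unique-resp-↭ (++-comm [ x ] xs) ur)

cycEdges-linked : ∀ (r : List A) → Linked (λ a b → (a , b) ∈ cycEdges r) r
cycEdges-linked []       = []
cycEdges-linked (x ∷ xs) = zip-linked x xs
  where
  zip-linked : ∀ {s} x xs → Linked (λ a b → (a , b) ∈ zip (x ∷ xs) (xs ++ s)) (x ∷ xs)
  zip-linked x []       = [-]
  zip-linked x (y ∷ ys) = here refl ∷ Linked.map there (zip-linked y ys)

private
  zip-∷ʳ : ∀ (x : A) xs y z → zip (x ∷ xs ++ [ y ]) (xs ++ y ∷ [ z ]) ≡ zip (x ∷ xs) (xs ++ [ y ]) ++ [ (y , z) ]
  zip-∷ʳ x []       y z = refl
  zip-∷ʳ x (u ∷ xs) y z = cong ((x , u) ∷_) (zip-∷ʳ u xs y z)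

cycEdges-rotate₁ : ∀ (a : A) xs → cycEdges (a ∷ xs) ↭ cycEdges (xs ++ [ a ])
cycEdges-rotate₁ a []       = ↭-refl
cycEdges-rotate₁ a (b ∷ xs) = subst ((a , b) ∷ zip (b ∷ xs) (xs ++ [ a ]) ↭_) (sym rotated)
  (++-comm [ (a , b) ] (zip (b ∷ xs) (xs ++ [ a ])))
  where
  rotated : cycEdges (b ∷ xs ++ [ a ]) ≡ zip (b ∷ xs) (xs ++ [ a ]) ++ [ (a , b) ]
  rotated = trans (cong (zip (b ∷ xs ++ [ a ])) (List.++-assoc xs [ a ] [ b ])) (zip-∷ʳ b xs a b)

cycEdges-rotate : ∀ (xs ys : List A) → cycEdges (xs ++ ys) ↭ cycEdges (ys ++ xs)
cycEdges-rotate []       ys rewrite List.++-identityʳ ys = ↭-refl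
cycEdges-rotate (x ∷ xs) ys = ↭-trans (cycEdges-rotate₁ x (xs ++ ys))
  (subst₂ (λ l l′ → cycEdges l ↭ cycEdges l′) (sym (List.++-assoc xs ys [ x ])) (List.++-assoc ys [ x ] xs)
          (cycEdges-rotate xs (ys ++ [ x ])))

module _ {n : ℕ} where

  joins : Fin n → Fin n → Fin n × Fin n → Bool
  joins i j (a , b) = (does (a ≟ᶠ i) ∧ does (b ≟ᶠ j)) ∨ (does (a ≟ᶠ j) ∧ does (b ≟ᶠ i))

  private
    ≟-sound : ∀ {a b : Fin n} → T (does (a ≟ᶠ b)) → a ≡ b
    ≟-sound {a} {b} t with a ≟ᶠ b
    ... | yes a≡b = a≡b

    ≟×≟-sound : ∀ {a b i j : Fin n} → T (does (a ≟ᶠ i) ∧ does (b ≟ᶠ j)) → (a , b) ≡ (i , j)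
    ≟×≟-sound t = cong₂ _,_ (≟-sound (proj₁ (Equivalence.to T-∧ t))) (≟-sound (proj₂ (Equivalence.to T-∧ t)))

  joins-sound : ∀ {i j} e → T (joins i j e) → e ≡ (i , j) ⊎ e ≡ (j , i)
  joins-sound (a , b) t = Sum.map ≟×≟-sound ≟×≟-sound (Equivalence.to T-∨ t)

  joins-complete : ∀ {i j} e → e ≡ (i , j) ⊎ e ≡ (j , i) → T (joins i j e)
  joins-complete {i} {j} _ (inj₁ refl) rewrite dec-true (i ≟ᶠ i) refl | dec-true (j ≟ᶠ j) refl = _
  joins-complete {i} {j} _ (inj₂ refl) rewrite dec-true (i ≟ᶠ i) refl | dec-true (j ≟ᶠ j) refl =
    subst T (sym (∨-zeroʳ (does (j ≟ᶠ i) ∧ does (i ≟ᶠ j)))) _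

  isEdge-complete : ∀ x {a b} → (a , b) ∈ cycEdges x ⊎ (b , a) ∈ cycEdges x → T (isEdge x a b)
  isEdge-complete x (inj₁ m) = any⁺ (joins _ _) (Any.map (λ e≡ → joins-complete _ (inj₁ (sym e≡))) m)
  isEdge-complete x (inj₂ m) = any⁺ (joins _ _) (Any.map (λ e≡ → joins-complete _ (inj₂ (sym e≡))) m)

  isEdge-sound : ∀ x {a b} → T (isEdge x a b) → (a , b) ∈ cycEdges x ⊎ (b , a) ∈ cycEdges x
  isEdge-sound x t with Any-⊎⁻ (Any.map (joins-sound _) (any⁻ (joins _ _) (cycEdges x) t))
  ... | inj₁ m = inj₁ (Any.map sym m)
  ... | inj₂ m = inj₂ (Any.map sym m)

  Πx-edge : ∀ x {a b} → a ≢ b → (a , b) ∈ cycEdges x ⊎ (b , a) ∈ cycEdges x → Πx n x a b ≡ πmax n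
  Πx-edge x {a} {b} a≢b e with a ≟ᶠ b
  ... | yes a≡b = ⊥-elim (a≢b a≡b)
  ... | no _ rewrite Equivalence.to T-≡ (isEdge-complete x e) = refl

  Πx-nonEdge : ∀ x {a b} → a ≢ b → (a , b) ∉ cycEdges x → (b , a) ∉ cycEdges x → Πx n x a b ≡ πmin n
  Πx-nonEdge x {a} {b} a≢b ab∉ ba∉ with a ≟ᶠ b
  ... | yes a≡b = ⊥-elim (a≢b a≡b)
  ... | no _ with isEdge x a b in eq
  ...   | true  = ⊥-elim ([ ab∉ , ba∉ ]′ (isEdge-sound x (subst T (sym eq) _)))
  ...   | false = refl

  Πx-nonNeg : ∀ x → 0ℚ ≤ πmax n → 0ℚ ≤ πmin n → ∀ a b → 0ℚ ≤ Πx n x a b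
  Πx-nonNeg x 0≤πmax 0≤πmin a b with a ≟ᶠ b
  ... | yes _ = ≤-refl
  ... | no _ with isEdge x a b
  ...   | true  = 0≤πmax
  ...   | false = 0≤πmin

pathProb : ∀ {n} → (Fin n → Fin n → ℚ) → Fin n → List (Fin n) → ℚ
pathProb π v []       = 1ℚ
pathProb π v (b ∷ ws) = safeDiv (π v b) (sumℚ (map (π v) (b ∷ ws))) * pathProb π b ws

module _ {n} (π : Fin n → Fin n → ℚ) (π-nonNeg : ∀ i j → 0ℚ ≤ π i j) (d : Fin n → Fin n → ℚ) (c : ℚ) where

  private
    indicator-nonNeg : ∀ b → 0ℚ ≤ indicator b
    indicator-nonNeg true  = 0≤1
    indicator-nonNeg false = ≤-refl

    choiceProb-nonNeg : ∀ v b U → 0ℚ ≤ safeDiv (π v b) (sumℚ (map (π v) U))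
    choiceProb-nonNeg v b U = safeDiv-nonNeg (π-nonNeg v b) (sumℚ-map-nonNeg (π v) (π-nonNeg v) U)

  runProb-nonNeg : ∀ k v U path → 0ℚ ≤ runProb π d c k v U path
  runProb-nonNeg k       v []       path = indicator-nonNeg (cost d path ≤ᵇ c)
  runProb-nonNeg zero    v (u ∷ U) path = ≤-refl
  runProb-nonNeg (suc k) v (u ∷ U) path = sumℚ-map-nonNeg _
    (λ (b , U′) → *-nonNeg (choiceProb-nonNeg v b (u ∷ U)) (runProb-nonNeg k b U′ _)) (picks (u ∷ U))

  -- runProb sums over every choice of the next vertex; keeping only the summand that follows ws gives the bound.
  pathProb-≤-runProb : ∀ ws k v U path → ws ↭ U → length U ℕ.≤ k →
    pathProb π v ws * indicator (cost d (path ++ ws) ≤ᵇ c) ≤ runProb π d c k v U path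
  pathProb-≤-runProb [] k v U path []↭U _ with ↭-empty-inv (↭-sym []↭U)
  ... | refl = ≤-reflexive (trans (*-identityˡ _) (cong (λ p → indicator (cost d p ≤ᵇ c)) (List.++-identityʳ path)))
  pathProb-≤-runProb (b ∷ ws) k v [] path b∷ws↭[] _ with () ← ∈-resp-↭ b∷ws↭[] (here refl)
  pathProb-≤-runProb (b ∷ ws) (suc k) v (u ∷ U) path b∷ws↭U (ℕ.s≤s |U|≤k)
    with U′ , b,U′∈picks , b∷U′↭U ← ∈-picks (∈-resp-↭ b∷ws↭U (here refl)) = begin
    choice (b ∷ ws) * pathProb π b ws * indicator (cost d (path ++ b ∷ ws) ≤ᵇ c)
      ≡⟨ *-assoc (choice (b ∷ ws)) _ _ ⟩
    choice (b ∷ ws) * (pathProb π b ws * indicator (cost d (path ++ b ∷ ws) ≤ᵇ c))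
      ≡⟨ cong₂ (λ s p → safeDiv (π v b) s * (pathProb π b ws * indicator (cost d p ≤ᵇ c)))
               (sumℚ-↭ (map⁺ (π v) b∷ws↭U)) (sym (List.++-assoc path [ b ] ws)) ⟩
    choice (u ∷ U) * (pathProb π b ws * indicator (cost d ((path ++ [ b ]) ++ ws) ≤ᵇ c))
      ≤⟨ *-monoˡ-≤-0≤ (choiceProb-nonNeg v b (u ∷ U))
           (pathProb-≤-runProb ws k b U′ (path ++ [ b ]) (drop-∷ (↭-trans b∷ws↭U (↭-sym b∷U′↭U)))
             (subst (ℕ._≤ k) (sym (ℕP.suc-injective (↭-length b∷U′↭U))) |U|≤k)) ⟩
    choice (u ∷ U) * runProb π d c k b U′ (path ++ [ b ])
      ≤⟨ ≤-sumℚ-map _ (λ (b , U′) → *-nonNeg (choiceProb-nonNeg v b (u ∷ U)) (runProb-nonNeg k b U′ _)) b,U′∈picks ⟩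
    runProb π d c (suc k) v (u ∷ U) path ∎
    where
    open ≤-Reasoning
    choice : List (Fin n) → ℚ
    choice W = safeDiv (π v b) (sumℚ (map (π v) W))

  genProb-≥ : ∀ {q} .{{_ : ℕ.NonZero n}} → (∀ v U → v ∷ U ↭ allFin n → q ≤ runProb π d c n v U [ v ]) →
              q ≤ genProb n π d c
  genProb-≥ {q} q≤runProb = begin
    q                                               ≡⟨ sym (*-identityˡ q) ⟩
    1ℚ * q                                          ≡⟨ cong (_* q) (sym n*1/n≡1) ⟩
    ℕtoℚ n * 1/n * q                                ≡⟨ *-assoc (ℕtoℚ n) 1/n q ⟩
    ℕtoℚ n * (1/n * q)                              ≡⟨ cong (λ m → ℕtoℚ m * (1/n * q)) (sym |picks|) ⟩
    ℕtoℚ (length (picks (allFin n))) * (1/n * q)    ≤⟨ sumℚ-map-≥ _ (picks (allFin n)) (λ {(v , U)} m →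
                                                         *-monoˡ-≤-0≤ 0≤1/n (q≤runProb v U (picks-↭ (allFin n) m))) ⟩
    genProb n π d c                                 ∎
    where
    open ≤-Reasoning
    1/n = safeDiv 1ℚ (ℕtoℚ n)
    0≤1/n = safeDiv-nonNeg 0≤1 (ℕtoℚ-nonNeg n)
    n*1/n≡1 : ℕtoℚ n * 1/n ≡ 1ℚ
    n*1/n≡1 = trans (*-comm (ℕtoℚ n) 1/n) (safeDiv-*-cancel 1ℚ (≢-sym (<⇒≢ (ℕtoℚ-positive n))))
    |picks| : length (picks (allFin n)) ≡ n
    |picks| = trans (length-picks (allFin n)) (length-allFin n)

rotate-to : ∀ {A : Set} {v : A} {x} → v ∈ x → Σ (List A) λ w → x ↭ v ∷ w × cycEdges x ↭ cycEdges (v ∷ w)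
rotate-to {v = v} v∈x with p , q , refl ← ∈-∃++ v∈x =
  q ++ p , ↭-trans (shift v p q) (↭-prep v (++-comm p q)) , cycEdges-rotate p (v ∷ q)

cost-↭ : ∀ {n} (d : Fin n → Fin n → ℚ) {x y} → cycEdges x ↭ cycEdges y → cost d x ≡ cost d y
cost-↭ d x~y = sumℚ-↭ (map⁺ _ x~y)

indicator-≤ᵇ : ∀ {p q} → p ≤ q → indicator (p ≤ᵇ q) ≡ 1ℚ
indicator-≤ᵇ {p} {q} p≤q with p ≤ᵇ q | ≤⇒≤ᵇ p≤q
... | true | _ = refl

module FollowTour {n} (x : List (Fin n)) (v w₁ : Fin n) (C : List (Fin n)) (wₘ : Fin n)
                  (tour-unique : Unique (v ∷ w₁ ∷ C ++ [ wₘ ]))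
                  (x~tour : cycEdges x ↭ cycEdges (v ∷ w₁ ∷ C ++ [ wₘ ])) where

  private
    tour : List (Fin n)
    tour = v ∷ w₁ ∷ C ++ [ wₘ ]

    π = Πx n x
    pM = πmax n
    pm = πmin n

    Edge : Fin n → Fin n → Set
    Edge a b = (a , b) ∈ cycEdges tour

    Π-edge : ∀ {a b} → a ≢ b → Edge a b → π a b ≡ pM
    Π-edge a≢b ab = Πx-edge x a≢b (inj₁ (∈-resp-↭ (↭-sym x~tour) ab))

    -- Successor and predecessor on the tour are unique, so y is joined to a only if it is one of them.
    Π-nonEdge : ∀ {a s p y} → Edge a s → Edge p a → y ≢ a → y ≢ s → y ≢ p → π a y ≡ pm
    Π-nonEdge {a} as pa y≢a y≢s y≢p = Πx-nonEdge x (≢-sym y≢a)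
      (λ ay → y≢s (cycEdges-successor-unique tour tour-unique (∈-resp-↭ x~tour ay) as))
      (λ ya → y≢p (cycEdges-predecessor-unique tour tour-unique (∈-resp-↭ x~tour ya) pa))

  pathProb-follow : ∀ {p a} B → Unique (p ∷ a ∷ B) → Linked Edge (p ∷ a ∷ B) →
                    pathProb π a B ≡ tourFollowProb pM pm (length B)
  pathProb-follow [] _ _ = refl
  pathProb-follow {p} {a} (b ∷ B) (p∉ ∷ a∉ ∷ u) (pa ∷ ab ∷ l) = begin
    safeDiv (π a b) (π a b + sumℚ (map (π a) B)) * pathProb π b B
      ≡⟨ cong (λ s → safeDiv s (s + sumℚ (map (π a) B)) * pathProb π b B) πab ⟩
    safeDiv pM (pM + sumℚ (map (π a) B)) * pathProb π b B
      ≡⟨ cong (λ s → safeDiv pM (pM + s) * pathProb π b B) (sumℚ-map-const (π a) B πay) ⟩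
    safeDiv pM (pM + ℕtoℚ (length B) * pm) * pathProb π b B
      ≡⟨ cong (safeDiv pM (pM + ℕtoℚ (length B) * pm) *_) (pathProb-follow B (a∉ ∷ u) (ab ∷ l)) ⟩
    safeDiv pM (pM + ℕtoℚ (length B) * pm) * tourFollowProb pM pm (length B) ∎
    where
    open ≡-Reasoning
    πab : π a b ≡ pM
    πab = Π-edge (All.head a∉) ab
    πay : ∀ {y} → y ∈ B → π a y ≡ pm
    πay y∈B = Π-nonEdge ab pa (≢-sym (All.lookup a∉ (there y∈B))) (≢-sym (All.lookup (AllPairs.head u) y∈B))
                (≢-sym (All.lookup p∉ (there (there y∈B))))

  pathProb-tour : pathProb π v (w₁ ∷ C ++ [ wₘ ]) ≡
                  safeDiv pM (pM + (ℕtoℚ (length C) * pm + (pM + 0ℚ))) * tourFollowProb pM pm (suc (length C))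
  pathProb-tour = begin
    safeDiv (π v w₁) (π v w₁ + sumℚ (map (π v) (C ++ [ wₘ ]))) * pathProb π w₁ (C ++ [ wₘ ])
      ≡⟨ cong (λ s → safeDiv (π v w₁) (π v w₁ + s) * pathProb π w₁ (C ++ [ wₘ ]))
              (trans (cong sumℚ (List.map-++ (π v) C [ wₘ ])) (sumℚ-++ (map (π v) C) [ π v wₘ ])) ⟩
    safeDiv (π v w₁) (π v w₁ + (sumℚ (map (π v) C) + (π v wₘ + 0ℚ))) * pathProb π w₁ (C ++ [ wₘ ])
      ≡⟨ firstStep-cong πvw₁ (sumℚ-map-const (π v) C πvy) πvwₘ follow ⟩
    safeDiv pM (pM + (ℕtoℚ (length C) * pm + (pM + 0ℚ))) * tourFollowProb pM pm (suc (length C)) ∎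
    where
    open ≡-Reasoning
    firstStep-cong : ∀ {s s′ t t′ u u′ p p′} → s ≡ s′ → t ≡ t′ → u ≡ u′ → p ≡ p′ →
                     safeDiv s (s + (t + (u + 0ℚ))) * p ≡ safeDiv s′ (s′ + (t′ + (u′ + 0ℚ))) * p′
    firstStep-cong refl refl refl refl = refl

    v∉ = AllPairs.head tour-unique
    w₁∉ = AllPairs.head (AllPairs.tail tour-unique)
    wₘ∉C = Unique[x∷xs]⇒x∉xs (Unique-resp-↭ (++-comm C [ wₘ ]) (AllPairs.tail (AllPairs.tail tour-unique)))

    linked : Linked Edge tour
    linked = cycEdges-linked tour

    closing : Edge wₘ v
    closing = ∈-resp-↭ (↭-sym (cycEdges-rotate (v ∷ w₁ ∷ C) [ wₘ ])) (here refl)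

    πvw₁ : π v w₁ ≡ pM
    πvw₁ = Π-edge (All.head v∉) (Linked.head linked)

    πvwₘ : π v wₘ ≡ pM
    πvwₘ = Πx-edge x (All.lookup v∉ (there (∈-++⁺ʳ C (here refl)))) (inj₂ (∈-resp-↭ (↭-sym x~tour) closing))

    πvy : ∀ {y} → y ∈ C → π v y ≡ pm
    πvy y∈C = Π-nonEdge (Linked.head linked) closing (≢-sym (All.lookup v∉ (there (∈-++⁺ˡ y∈C))))
                (≢-sym (All.lookup w₁∉ (∈-++⁺ˡ y∈C))) (λ y≡wₘ → wₘ∉C (subst (_∈ C) y≡wₘ y∈C))

    follow : pathProb π w₁ (C ++ [ wₘ ]) ≡ tourFollowProb pM pm (suc (length C))
    follow = trans (pathProb-follow (C ++ [ wₘ ]) tour-unique linked)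
                   (cong (tourFollowProb pM pm) (trans (List.length-++ C) (ℕP.+-comm (length C) 1)))

module _ (i : ℕ) where

  private
    n = 4 ℕ.+ i

  πmin-nonNeg : 0ℚ ≤ πmin n
  πmin-nonNeg = safeDiv-nonNeg 0≤1 (ℕtoℚ-nonNeg (n ℕ.* (n ℕ.∸ 2)))

  πmin-*-≤1 : ∀ {m} → m ℕ.≤ n ℕ.* (n ℕ.∸ 2) → πmin n * ℕtoℚ m ≤ 1ℚ
  πmin-*-≤1 m≤ = subst (πmin n * _ ≤_) (safeDiv-*-cancel 1ℚ (≢-sym (<⇒≢ (ℕtoℚ-positive (n ℕ.* (n ℕ.∸ 2))))))
                   (*-monoˡ-≤-0≤ πmin-nonNeg (ℕtoℚ-mono-≤ m≤))

  ¾≤πmax : ¾ ≤ πmax n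
  ¾≤πmax = ≤-by-gap (¼ * (1ℚ - 1/n * ℕtoℚ 4))
    (solve 1 (λ q → con 1ℚ :- q := con ¾ :+ con ¼ :* (con 1ℚ :- q :* con (ℕtoℚ 4))) refl 1/n)
    (*-nonNeg 0≤¼ (p≤q⇒0≤q-p (subst (1/n * ℕtoℚ 4 ≤_) (safeDiv-*-cancel 1ℚ (≢-sym (<⇒≢ (ℕtoℚ-positive n))))
                                   (*-monoˡ-≤-0≤ (safeDiv-nonNeg 0≤1 (ℕtoℚ-nonNeg n)) (ℕtoℚ-mono-≤ (ℕP.m≤m+n 4 i))))))
    where 1/n = safeDiv 1ℚ (ℕtoℚ n)

  πmax-nonNeg : 0ℚ ≤ πmax n
  πmax-nonNeg = ≤-trans 0≤¾ ¾≤πmax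

  pathProb-tour-≥ : ∀ x v w → Unique (v ∷ w) → cycEdges x ↭ cycEdges (v ∷ w) → length w ≡ 3 ℕ.+ i →
                    1/12 ≤ pathProb (Πx n x) v w
  pathProb-tour-≥ x v (w₁ ∷ w′) u x~vw |w|≡ with length≡suc⇒∷ʳ w′ (suc i) (ℕP.suc-injective |w|≡)
  ... | C , wₘ , refl , |C|≡ rewrite FollowTour.pathProb-tour x v w₁ C wₘ u x~vw | |C|≡ =
    firstStep*tourFollowProb-≥ ¾≤πmax πmin-nonNeg (suc i)
      (πmin-*-≤1 (ℕP.≤-trans (ℕP.n≤1+n (suc i)) (ℕP.m≤n*m (2 ℕ.+ i) n)))
      (subst (λ q → πmin n * q ≤ 1ℚ) (ℕtoℚ-* (2 ℕ.+ i) (2 ℕ.+ i))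
             (πmin-*-≤1 (ℕP.*-monoˡ-≤ (2 ℕ.+ i) (ℕP.+-monoˡ-≤ i {2} {4} (ℕ.s≤s (ℕ.s≤s ℕ.z≤n))))))

  runProb-≥ : ∀ (d : Fin n → Fin n → ℚ) x → x ↭ allFin n → ∀ v U → v ∷ U ↭ allFin n →
              1/12 ≤ runProb (Πx n x) d (cost d x) n v U [ v ]
  runProb-≥ d x x↭all v U vU↭all
    with w , x↭vw , x~vw ← rotate-to (∈-resp-↭ (↭-sym x↭all) (∈-resp-↭ vU↭all (here refl))) = begin
    1/12                                                        ≡⟨ sym (*-identityʳ 1/12) ⟩
    1/12 * 1ℚ                                                   ≤⟨ *-monoʳ-≤-0≤ 0≤1 (pathProb-tour-≥ x v w vw-unique x~vw |w|≡) ⟩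
    pathProb (Πx n x) v w * 1ℚ                                  ≡⟨ cong (pathProb (Πx n x) v w *_) (sym reproduces-x) ⟩
    pathProb (Πx n x) v w * indicator (cost d (v ∷ w) ≤ᵇ cost d x)
      ≤⟨ pathProb-≤-runProb (Πx n x) (Πx-nonNeg x πmax-nonNeg πmin-nonNeg) d (cost d x) w n v U [ v ] w↭U |U|≤n ⟩
    runProb (Πx n x) d (cost d x) n v U [ v ]                   ∎
    where
    open ≤-Reasoning
    vw-unique : Unique (v ∷ w)
    vw-unique = Unique-resp-↭ (↭-trans (↭-sym x↭all) x↭vw) (allFin⁺ n)
    vw↭all : v ∷ w ↭ allFin n
    vw↭all = ↭-trans (↭-sym x↭vw) x↭all
    w↭U : w ↭ U
    w↭U = drop-∷ (↭-trans vw↭all (↭-sym vU↭all))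
    |w|≡ : length w ≡ 3 ℕ.+ i
    |w|≡ = ℕP.suc-injective (trans (↭-length vw↭all) (length-allFin n))
    |U|≤n : length U ℕ.≤ n
    |U|≤n = subst (length U ℕ.≤_) (trans (↭-length vU↭all) (length-allFin n)) (ℕP.n≤1+n (length U))
    reproduces-x : indicator (cost d (v ∷ w) ≤ᵇ cost d x) ≡ 1ℚ
    reproduces-x = indicator-≤ᵇ (≤-reflexive (sym (cost-↭ d {x} {v ∷ w} x~vw)))

claim2 : Σ ℚ λ c → (0ℚ < c) × Σ ℕ λ N →
           (n : ℕ) → N Data.Nat.≤ n →
           (d : Fin n → Fin n → ℚ) → (∀ i j → d i j ≡ d j i) → (∀ i j → 0ℚ ≤ d i j) →
           (x : List (Fin n)) → x ↭ allFin n →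
           c ≤ genProb n (Πx n x) d (cost d x)
claim2 = 1/12 , *<* (ℤ.+<+ (ℕ.s≤s ℕ.z≤n)) , 4 ,
  λ { (suc (suc (suc (suc i)))) (ℕ.s≤s (ℕ.s≤s (ℕ.s≤s (ℕ.s≤s ℕ.z≤n)))) d _ _ x x↭all →
        genProb-≥ (Πx _ x) (Πx-nonNeg x (πmax-nonNeg i) (πmin-nonNeg i)) d (cost d x) (runProb-≥ i d x x↭all) }
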